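{- Let $G$ be a $k\frac{1}{2}$-extendable graph on $\nu$ vertices. Then $\alpha(G)\leq (\nu-1)/2-k$. Moreover, this upper bound is sharp for all $k$ and $\nu$, i.e., for all such admissible $k$ and $\nu$ there is a $k\frac{1}{2}$-extendable graph on $\nu$ vertices with independence number exactly $(\nu-1)/2-k$.
   Context: All graphs are undirected, simple, finite and connected. $\alpha(G)$ is the independence number of $G$. A connected graph $G$ (of odd order) is $k\frac{1}{2}$-extendable if (1) for every vertex $v$ of $G$ there is a matching of size $k$ in $G-v$, and (2) for every vertex $v$ of $G$, every matching of size $k$ in $G-v$ is contained in a perfect matching of $G-v$. -}

module Defs where

open import Data.Nat using (ℕ; _≤_; _+_; _*_; _∸_; _/_)
open import Data.Bool using (Bool; true; false)
open import Data.Fin using (Fin)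
open import Data.Fin.Subset using (Subset; _∈_; ∣_∣)
open import Data.List using (List; []; _∷_; concatMap; length)
open import Data.List.Relation.Unary.All using (All)
open import Data.List.Relation.Unary.Unique.Propositional using (Unique)
import Data.List.Membership.Propositional as LM
open import Data.Product using (_×_; _,_; proj₁; proj₂; ∃)
open import Data.Sum using (_⊎_)
open import Relation.Binary.PropositionalEquality using (_≡_; _≢_)
open import Relation.Nullary using (¬_)

record Graph (n : ℕ) : Set where
  field
    adj    : Fin n → Fin n → Bool
    adj-sym    : ∀ u v → adj u v ≡ adj v u
    adj-irrefl : ∀ v → adj v v ≡ false
open Graph public

module _ {n : ℕ} (G : Graph n) where

  data Reach : Fin n → Fin n → Set where
    here : ∀ {u} → Reach u u
    step : ∀ {u w v} → adj G u w ≡ true → Reach w v → Reach u v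

  Connected : Set
  Connected = ∀ u v → Reach u v

  Independent : Subset n → Set
  Independent I = ∀ u v → u ∈ I → v ∈ I → adj G u v ≡ false

  IsIndependenceNumber : ℕ → Set
  IsIndependenceNumber a =
    ∃ (λ I → Independent I × ∣ I ∣ ≡ a) × (∀ I → Independent I → ∣ I ∣ ≤ a)

  verts : List (Fin n × Fin n) → List (Fin n)
  verts = concatMap (λ e → proj₁ e ∷ proj₂ e ∷ [])

  IsMatching : List (Fin n × Fin n) → Set
  IsMatching M = All (λ e → adj G (proj₁ e) (proj₂ e) ≡ true) M × Unique (verts M)

  MatchingAvoiding : Fin n → List (Fin n × Fin n) → Set
  MatchingAvoiding v M = IsMatching M × ¬ (v LM.∈ verts M)

  PerfectAvoiding : Fin n → List (Fin n × Fin n) → Set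
  PerfectAvoiding v P = MatchingAvoiding v P × (∀ w → w ≢ v → w LM.∈ verts P)

  ContainedIn : List (Fin n × Fin n) → List (Fin n × Fin n) → Set
  ContainedIn M P = All (λ e → (e LM.∈ P) ⊎ ((proj₂ e , proj₁ e) LM.∈ P)) M

  -- k½-extendable (connectedness included; odd order is a hypothesis of the theorem)
  HalfExtendable : ℕ → Set
  HalfExtendable k =
    Connected ×
    (∀ v → ∃ (λ M → MatchingAvoiding v M × length M ≡ k)) ×
    (∀ v M → MatchingAvoiding v M → length M ≡ k →
       ∃ (λ P → PerfectAvoiding v P × ContainedIn M P))

-- Write n = 2m + 1 and let I be an independent set with two distinct vertices u and x (smaller
-- sets satisfy the bound trivially). A perfect matching P of G − u has m edges, each meeting I at most once,
-- and it covers I − u, so more than m − |I| of its edges are interior (miss I). Let w be the partner of x in P;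
-- then w ∉ I, and since at most one edge of P contains w, a k-matching M ⊆ P avoiding w can include
-- p = min(k, #interior edges of P) interior edges. A perfect matching Q of G − w extending M covers I with
-- distinct edges and contains those p interior edges, so |I| + p ≤ m; by the bound on P, p must be k.
--
-- In the complete split graph with an independent part S of m − k vertices, every matching M of
-- G − v with |M| + |S| ≤ m extends to a perfect matching of G − v: list the 2(m − |M|) uncovered vertices
-- with those of S first and pair the first half with the second half, which avoids S.

module Submission where

open import Defs
open import Data.Bool using (Bool; true; not; _∧_)
open import Data.Bool.Properties using (∧-comm; ∧-zeroʳ)
open import Data.Empty using (⊥-elim)
open import Data.Fin using (Fin; zero; suc) renaming (_≟_ to _≟ᶠ_)
open import Data.Fin.Properties as Fin using (any?)
open import Data.Fin.Subset using (Subset; inside; outside; ∣_∣; ⁅_⁆)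
  renaming (_∈_ to _∈ₛ_; _∉_ to _∉ₛ_; _⊆_ to _⊆ₛ_; ⊥ to ∅)
open import Data.Fin.Subset.Properties using (_∈?_; ∣⊥∣≡0; p⊆q⇒∣p∣≤∣q∣; ∣⁅x⁆∣≡1; x∈⁅x⁆)
open import Data.List using (List; []; _∷_; _++_; length; filter; take; drop; map; concatMap; zip; allFin)
open import Data.List.Properties
  using ( length-++; length-take; length-drop; length-map; length-tabulate; take++drop≡id
        ; filter-notAll; filter-none; filter-all; filter-accept; filter-reject )
open import Data.List.Membership.Propositional using (_∈_; _∉_)
open import Data.List.Membership.Propositional.Properties
  using (∈-++⁻; ∈-++⁺ˡ; ∈-++⁺ʳ; ∈-filter⁺; ∈-filter⁻; ∈-allFin; ∈-map⁺; ∈-map⁻; ∈-concat⁺′; ∈-concat⁻′)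
import Data.List.Membership.DecPropositional as DecMembership
open import Data.List.Relation.Binary.Disjoint.Propositional using (Disjoint)
open import Data.List.Relation.Binary.Permutation.Propositional
  using (_↭_; ↭-refl; ↭-sym; ↭-trans; prep; ↭⇒↭ₛ)
open import Data.List.Relation.Binary.Permutation.Propositional.Properties using (shift; ∈-resp-↭; ↭-length)
import Data.List.Relation.Binary.Permutation.Setoid.Properties as PermutationSetoid
open import Data.List.Relation.Binary.Subset.Propositional using (_⊆_)
open import Data.List.Relation.Binary.Sublist.Propositional
  using ([]; _∷_; _∷ʳ_; lookup; minimum) renaming (_⊆_ to _⊑_)
open import Data.List.Relation.Binary.Sublist.Propositional.Properties
  using (All-resp-⊆; drop-⊆; take-⊆; filter-⊆; filter⁺; length-mono-≤)
open import Data.List.Relation.Unary.All as All using (All; []; _∷_)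
open import Data.List.Relation.Unary.All.Properties as All using ()
open import Data.List.Relation.Unary.Any as Any using (here; there)
open import Data.List.Relation.Unary.Unique.Propositional using (Unique; []; _∷_)
open import Data.List.Relation.Unary.Unique.Propositional.Properties as Unique
  using (allFin⁺; Unique[x∷xs]⇒x∉xs)
open import Data.Nat using (ℕ; zero; suc; _+_; _*_; _∸_; _⊓_; _/_; _%_; _≤_; _<_; z≤n; s≤s)
open import Data.Nat.DivMod using (m≡m%n+[m/n]*n; m*n/n≡m)
open import Data.Nat.Properties
  using ( ≤-trans; ≤-antisym; ≤-reflexive; ≤-pred; n≤1+n; ≮⇒≥; <⇒≱; suc-injective
        ; +-suc; +-comm; +-cancelʳ-≡; +-mono-<; +-monoˡ-<; +-monoˡ-≤; +-monoʳ-≤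
        ; m≤m+n; m∸n≤m; m+n∸m≡n; m+[n∸m]≡n; m+n≤o⇒m≤o; m+n≤o⇒n≤o; m+n≤o⇒m≤o∸n
        ; m≤n⇒m⊓n≡m; ⊓-sel; module ≤-Reasoning )
open import Data.Nat.Tactic.RingSolver using (solve-∀)
open import Data.Product using (_×_; _,_; proj₁; proj₂; ∃; swap)
open import Data.Sum as Sum using (_⊎_; inj₁; inj₂)
open import Data.Vec using ([]; _∷_) renaming (here to hereᵥ; there to thereᵥ)
open import Function using (_∘_)
open import Relation.Binary.Definitions using (DecidableEquality)
open import Relation.Binary.PropositionalEquality
  using (_≡_; _≢_; refl; sym; trans; cong; cong₂; subst; subst₂; setoid; module ≡-Reasoning)
open import Relation.Nullary using (¬_; Dec; yes; no; ¬?; does)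
open import Relation.Nullary.Decidable using (_⊎-dec_; _×-dec_; dec-true; dec-false)
open import Relation.Unary using (Pred; Decidable; ∁)
open import Relation.Unary.Properties using (∁?)

module _ {A : Set} where

  Unique-resp-⊒ : {xs ys : List A} → xs ⊑ ys → Unique ys → Unique xs
  Unique-resp-⊒ []         []       = []
  Unique-resp-⊒ (y ∷ʳ τ)   (_ ∷ u)  = Unique-resp-⊒ τ u
  Unique-resp-⊒ (refl ∷ τ) (x ∷ u)  = All-resp-⊆ τ x ∷ Unique-resp-⊒ τ u

  ∉⇒Unique-∷ : ∀ {x} {xs : List A} → x ∉ xs → Unique xs → Unique (x ∷ xs)
  ∉⇒Unique-∷ {xs = xs} x∉ u = All.¬Any⇒All¬ xs x∉ ∷ u

  Unique-resp-↭ : {xs ys : List A} → xs ↭ ys → Unique xs → Unique ys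
  Unique-resp-↭ p = PermutationSetoid.Unique-resp-↭ (setoid A) (↭⇒↭ₛ p)

  filter++filter-∁-↭ : ∀ {ℓ} {P : Pred A ℓ} (P? : Decidable P) (xs : List A) →
    filter P? xs ++ filter (∁? P?) xs ↭ xs
  filter++filter-∁-↭ P? []       = ↭-refl
  filter++filter-∁-↭ P? (x ∷ xs) with P? x
  ... | yes _ = prep x (filter++filter-∁-↭ P? xs)
  ... | no  _ = ↭-trans (shift x (filter P? xs) (filter (∁? P?) xs)) (prep x (filter++filter-∁-↭ P? xs))

  length-filter+length-filter-∁ : ∀ {ℓ} {P : Pred A ℓ} (P? : Decidable P) (xs : List A) →
    length (filter P? xs) + length (filter (∁? P?) xs) ≡ length xs
  length-filter+length-filter-∁ P? xs =
    trans (sym (length-++ (filter P? xs))) (↭-length (filter++filter-∁-↭ P? xs))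

  take-⊑-take-++ : ∀ k (xs ys : List A) → take k xs ⊑ take k (xs ++ ys)
  take-⊑-take-++ zero    xs       ys = []
  take-⊑-take-++ (suc k) []       ys = minimum _
  take-⊑-take-++ (suc k) (x ∷ xs) ys = refl ∷ take-⊑-take-++ k xs ys

  ⊑⇒length≤length-filter : ∀ {ℓ} {P : Pred A ℓ} (P? : Decidable P) {xs ys : List A} →
    All P xs → xs ⊑ ys → length xs ≤ length (filter P? ys)
  ⊑⇒length≤length-filter P? pxs τ =
    subst (_≤ _) (cong length (filter-all P? pxs)) (length-mono-≤ (filter⁺ P? P? (λ { refl p → p }) τ))

  drop-++-⊆ʳ : ∀ r (xs ys : List A) → length xs ≤ r → drop r (xs ++ ys) ⊆ ys
  drop-++-⊆ʳ r       []       ys _         = lookup (drop-⊆ r ys)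
  drop-++-⊆ʳ (suc r) (x ∷ xs) ys (s≤s le)  = drop-++-⊆ʳ r xs ys le

module _ {A : Set} (_≟_ : DecidableEquality A) where

  length-mono-⊆ : {xs ys : List A} → Unique xs → xs ⊆ ys → length xs ≤ length ys
  length-mono-⊆ {[]}     _       _   = z≤n
  length-mono-⊆ {x ∷ xs} {ys} (x∉ ∷ u) sub =
    ≤-trans (s≤s (length-mono-⊆ u sub′))
            (filter-notAll (λ z → ¬? (z ≟ x)) ys (Any.map (λ x≡z z≢x → z≢x (sym x≡z)) (sub (here refl))))
    where
    sub′ : xs ⊆ filter (λ z → ¬? (z ≟ x)) ys
    sub′ z∈ = ∈-filter⁺ (λ z → ¬? (z ≟ x)) (sub (there z∈)) (λ { refl → All.lookup x∉ z∈ refl })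

module _ {n : ℕ} where

  open DecMembership (_≟ᶠ_ {n}) using () renaming (_∈?_ to _∈ˡ?_)

  length-allFin : length (allFin n) ≡ n
  length-allFin = length-tabulate (λ i → i)

  length-enumeration : {xs : List (Fin n)} → Unique xs → (∀ z → z ∈ xs) → length xs ≡ n
  length-enumeration {xs} u every = ≤-antisym
    (subst (length xs ≤_) length-allFin (length-mono-⊆ _≟ᶠ_ u (λ {z} _ → ∈-allFin z)))
    (subst (_≤ length xs) length-allFin (length-mono-⊆ _≟ᶠ_ (allFin⁺ n) (λ {z} _ → every z)))

  length-unlisted : {xs : List (Fin n)} → Unique xs →
    length (filter (λ z → ¬? (z ∈ˡ? xs)) (allFin n)) + length xs ≡ n
  length-unlisted {xs} u = trans (sym (length-++ unlisted))
    (length-enumeration (Unique.++⁺ (Unique.filter⁺ _ (allFin⁺ n)) u disjoint) every)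
    where
    unlisted = filter (λ z → ¬? (z ∈ˡ? xs)) (allFin n)
    disjoint : Disjoint unlisted xs
    disjoint (z∈ , z∈xs) = proj₂ (∈-filter⁻ (λ z → ¬? (z ∈ˡ? xs)) {xs = allFin n} z∈) z∈xs
    every : ∀ z → z ∈ unlisted ++ xs
    every z with z ∈ˡ? xs
    ... | yes z∈xs = ∈-++⁺ʳ unlisted z∈xs
    ... | no  z∉xs = ∈-++⁺ˡ (∈-filter⁺ (λ z → ¬? (z ∈ˡ? xs)) (∈-allFin z) z∉xs)

elements : ∀ {n} → Subset n → List (Fin n)
elements []            = []
elements (inside ∷ S)  = zero ∷ map suc (elements S)
elements (outside ∷ S) = map suc (elements S)

length-elements : ∀ {n} (S : Subset n) → length (elements S) ≡ ∣ S ∣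
length-elements []            = refl
length-elements (inside ∷ S)  = cong suc (trans (length-map suc (elements S)) (length-elements S))
length-elements (outside ∷ S) = trans (length-map suc (elements S)) (length-elements S)

∈-elements⁺ : ∀ {n} {S : Subset n} {z} → z ∈ₛ S → z ∈ elements S
∈-elements⁺ {S = inside ∷ S}  hereᵥ      = here refl
∈-elements⁺ {S = inside ∷ S}  (thereᵥ p) = there (∈-map⁺ suc (∈-elements⁺ p))
∈-elements⁺ {S = outside ∷ S} (thereᵥ p) = ∈-map⁺ suc (∈-elements⁺ p)

∈-elements⁻ : ∀ {n} {S : Subset n} {z} → z ∈ elements S → z ∈ₛ S
∈-elements⁻ {S = inside ∷ S} (here refl) = hereᵥ
∈-elements⁻ {S = inside ∷ S} (there p) with ∈-map⁻ suc p
... | _ , q , refl = thereᵥ (∈-elements⁻ q)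
∈-elements⁻ {S = outside ∷ S} p with ∈-map⁻ suc p
... | _ , q , refl = thereᵥ (∈-elements⁻ q)

Unique-elements : ∀ {n} (S : Subset n) → Unique (elements S)
Unique-elements []            = []
Unique-elements (inside ∷ S)  =
  All.tabulate (λ p → λ { refl → zero∉ p }) ∷ Unique.map⁺ Fin.suc-injective (Unique-elements S)
  where
  zero∉ : zero ∉ map suc (elements S)
  zero∉ p with ∈-map⁻ suc p
  ... | _ , _ , ()
Unique-elements (outside ∷ S) = Unique.map⁺ Fin.suc-injective (Unique-elements S)

∣p∣<n⇒∃∉ : ∀ {n} (p : Subset n) → ∣ p ∣ < n → ∃ λ c → c ∉ₛ p
∣p∣<n⇒∃∉ (outside ∷ p) _         = zero , λ ()
∣p∣<n⇒∃∉ (inside ∷ p)  (s≤s p<n) with ∣p∣<n⇒∃∉ p p<n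
... | c , c∉p = suc c , λ { (thereᵥ c∈p) → c∉p c∈p }

subset-of-size : ∀ {n} t → t ≤ n → ∃ λ (S : Subset n) → ∣ S ∣ ≡ t
subset-of-size {n}     zero    _         = ∅ , ∣⊥∣≡0 n
subset-of-size {suc n} (suc t) (s≤s t≤n) with subset-of-size t t≤n
... | S , ∣S∣≡t = inside ∷ S , cong suc ∣S∣≡t

half-mono-≤ : ∀ a b → a + a ≤ b + b → a ≤ b
half-mono-≤ a b le = ≮⇒≥ (λ b<a → <⇒≱ (+-mono-< b<a b<a) le)

+⊓-≤⇒+-≤ : ∀ a k p m → a + k ⊓ p ≤ m → m < a + p → a + k ≤ m
+⊓-≤⇒+-≤ a k p m le m<a+p with ⊓-sel k p
... | inj₁ k⊓p≡k = subst (λ z → a + z ≤ m) k⊓p≡k le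
... | inj₂ k⊓p≡p = ⊥-elim (<⇒≱ m<a+p (subst (λ z → a + z ≤ m) k⊓p≡p le))

half-injective : ∀ {a b} → a + a ≡ b + b → a ≡ b
half-injective {a} {b} eq =
  ≤-antisym (half-mono-≤ a b (≤-reflexive eq)) (half-mono-≤ b a (≤-reflexive (sym eq)))

ends : {A : Set} → A × A → List A
ends e = proj₁ e ∷ proj₂ e ∷ []

∈-ends-swap : {A : Set} {z : A} (e : A × A) → z ∈ ends e → z ∈ ends (swap e)
∈-ends-swap e (here refl)         = there (here refl)
∈-ends-swap e (there (here refl)) = here refl

module _ {A : Set} where

  concatMap-ends-zip-↭ : ∀ {xs ys : List A} → length xs ≡ length ys →
    concatMap ends (zip xs ys) ↭ xs ++ ys
  concatMap-ends-zip-↭ {[]}     {[]}     _  = ↭-refl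
  concatMap-ends-zip-↭ {x ∷ xs} {y ∷ ys} eq =
    prep x (↭-trans (prep y (concatMap-ends-zip-↭ {xs} {ys} (suc-injective eq))) (↭-sym (shift y xs ys)))

  All-zip-proj₂ : ∀ {ℓ} {P : Pred A ℓ} (xs : List A) {ys} → All P ys → All (P ∘ proj₂) (zip xs ys)
  All-zip-proj₂ []       _          = []
  All-zip-proj₂ (x ∷ xs) []         = []
  All-zip-proj₂ (x ∷ xs) (py ∷ pys) = py ∷ All-zip-proj₂ xs pys

module _ {n : ℕ} (G : Graph n) where

  private
    E = Fin n × Fin n
    open DecMembership (_≟ᶠ_ {n}) using () renaming (_∈?_ to _∈ˡ?_)

  verts-++ : (L L′ : List E) → verts G (L ++ L′) ≡ verts G L ++ verts G L′
  verts-++ []      L′ = refl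
  verts-++ (e ∷ L) L′ = cong (λ vs → proj₁ e ∷ proj₂ e ∷ vs) (verts-++ L L′)

  length-verts : (L : List E) → length (verts G L) ≡ length L + length L
  length-verts []      = refl
  length-verts (e ∷ L) = cong suc (trans (cong suc (length-verts L)) (sym (+-suc _ _)))

  ∈-verts⁺ : ∀ {L : List E} {e z} → e ∈ L → z ∈ ends e → z ∈ verts G L
  ∈-verts⁺ e∈ z∈ = ∈-concat⁺′ z∈ (∈-map⁺ ends e∈)

  ∈-verts⁻ : ∀ {L : List E} {z} → z ∈ verts G L → ∃ λ e → e ∈ L × z ∈ ends e
  ∈-verts⁻ {L} z∈ with ∈-concat⁻′ (map ends L) z∈
  ... | _ , z∈vs , vs∈ with ∈-map⁻ ends vs∈
  ...   | e , e∈ , refl = e , e∈ , z∈vs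

  verts-⊑ : ∀ {L L′ : List E} → L ⊑ L′ → verts G L ⊑ verts G L′
  verts-⊑ []         = []
  verts-⊑ (e ∷ʳ τ)   = proj₁ e ∷ʳ proj₂ e ∷ʳ verts-⊑ τ
  verts-⊑ (refl ∷ τ) = refl ∷ refl ∷ verts-⊑ τ

  IsMatching-resp-⊒ : ∀ {L L′ : List E} → L ⊑ L′ → IsMatching G L′ → IsMatching G L
  IsMatching-resp-⊒ τ (edges , u) = All-resp-⊆ τ edges , Unique-resp-⊒ (verts-⊑ τ) u

  ends-∉-verts : ∀ {e : E} {L z} → Unique (verts G (e ∷ L)) → z ∈ ends e → z ∉ verts G L
  ends-∉-verts u       (here refl)         p = Unique[x∷xs]⇒x∉xs u (there p)
  ends-∉-verts (_ ∷ u) (there (here refl)) p = Unique[x∷xs]⇒x∉xs u p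

  ends-distinct : ∀ {L : List E} {e} → Unique (verts G L) → e ∈ L → proj₁ e ≢ proj₂ e
  ends-distinct (x∉ ∷ _)    (here refl) = All.head x∉
  ends-distinct (_ ∷ _ ∷ u) (there e∈)  = ends-distinct u e∈

  partner : ∀ {e : E} {x} → adj G (proj₁ e) (proj₂ e) ≡ true → x ∈ ends e →
    ∃ λ w → w ∈ ends e × adj G x w ≡ true
  partner     ab (here refl)         = _ , there (here refl) , ab
  partner {e} ab (there (here refl)) = _ , here refl , trans (adj-sym G (proj₂ e) (proj₁ e)) ab

  edge-of-vertex-unique : ∀ {L : List E} {e f z} → Unique (verts G L) →
    e ∈ L → f ∈ L → z ∈ ends e → z ∈ ends f → e ≡ f
  edge-of-vertex-unique         u           (here refl) (here refl) _  _  = refl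
  edge-of-vertex-unique {_ ∷ L} u           (here refl) (there f∈)  ze zf =
    ⊥-elim (ends-∉-verts {L = L} u ze (∈-verts⁺ f∈ zf))
  edge-of-vertex-unique {_ ∷ L} u           (there e∈)  (here refl) ze zf =
    ⊥-elim (ends-∉-verts {L = L} u zf (∈-verts⁺ e∈ ze))
  edge-of-vertex-unique         (_ ∷ _ ∷ u) (there e∈)  (there f∈)  ze zf = edge-of-vertex-unique u e∈ f∈ ze zf

  Disjoint-verts-filter : ∀ {ℓ} {P Q : Pred E ℓ} (P? : Decidable P) (Q? : Decidable Q) {L : List E} →
    Unique (verts G L) → (∀ {e} → P e → ¬ Q e) → Disjoint (verts G (filter P? L)) (verts G (filter Q? L))
  Disjoint-verts-filter {Q = Q} P? Q? {L} u P⇒¬Q (zP , zQ)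
    with ∈-verts⁻ {filter P? L} zP | ∈-verts⁻ {filter Q? L} zQ
  ... | e , e∈ , ze | f , f∈ , zf with ∈-filter⁻ P? {xs = L} e∈ | ∈-filter⁻ Q? {xs = L} f∈
  ...   | e∈L , Pe | f∈L , Qf = P⇒¬Q Pe (subst Q (sym (edge-of-vertex-unique u e∈L f∈L ze zf)) Qf)

  length-filter-∋≤1 : ∀ {L : List E} z → Unique (verts G L) →
    length (filter (λ e → z ∈ˡ? ends e) L) ≤ 1
  length-filter-∋≤1 {[]}    z u = z≤n
  length-filter-∋≤1 {e ∷ L} z u with z ∈ˡ? ends e
  ... | yes z∈e = ≤-reflexive (cong length (trans (filter-accept (λ f → z ∈ˡ? ends f) {xs = L} z∈e)
                    (cong (e ∷_) (filter-none (λ f → z ∈ˡ? ends f) {xs = L}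
                      (All.tabulate (λ f∈ z∈f → ends-∉-verts {L = L} u z∈e (∈-verts⁺ f∈ z∈f)))))))
  ... | no  z∉e with u
  ...   | _ ∷ _ ∷ u′ =
    subst (_≤ 1) (cong length (sym (filter-reject (λ f → z ∈ˡ? ends f) {xs = L} z∉e)))
          (length-filter-∋≤1 {L} z u′)

  IsMatching-++ : ∀ {L L′ : List E} → IsMatching G L → IsMatching G L′ →
    Disjoint (verts G L) (verts G L′) → IsMatching G (L ++ L′)
  IsMatching-++ {L} {L′} (eL , uL) (eL′ , uL′) disjoint =
    All.++⁺ eL eL′ , subst Unique (sym (verts-++ L L′)) (Unique.++⁺ uL uL′ disjoint)

  length-≤-ContainedIn : ∀ {M Q : List E} → Unique (verts G M) → ContainedIn G M Q → length M ≤ length Q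
  length-≤-ContainedIn {M} {Q} u M⊆Q =
    half-mono-≤ _ _ (subst₂ _≤_ (length-verts M) (length-verts Q) (length-mono-⊆ _≟ᶠ_ u vM⊆vQ))
    where
    vM⊆vQ : verts G M ⊆ verts G Q
    vM⊆vQ z∈ with ∈-verts⁻ z∈
    ... | e , e∈ , ze with All.lookup M⊆Q e∈
    ...   | inj₁ e∈Q  = ∈-verts⁺ e∈Q ze
    ...   | inj₂ e′∈Q = ∈-verts⁺ e′∈Q (∈-ends-swap e ze)

  length-PerfectAvoiding : ∀ {m v P} → n ≡ suc (m + m) → PerfectAvoiding G v P → length P ≡ m
  length-PerfectAvoiding {m} {v} {P} n≡1+2m (((_ , u) , v∉) , covers) = half-injective (suc-injective (begin
    suc (length P + length P)  ≡⟨ cong suc (length-verts P) ⟨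
    length (v ∷ verts G P)     ≡⟨ length-enumeration (∉⇒Unique-∷ v∉ u) cover ⟩
    n                          ≡⟨ n≡1+2m ⟩
    suc (m + m)                ∎))
    where
    open ≡-Reasoning
    cover : ∀ z → z ∈ v ∷ verts G P
    cover z with z ≟ᶠ v
    ... | yes z≡v = here z≡v
    ... | no  z≢v = there (covers z z≢v)

module _ {n : ℕ} (I : Subset n) where

  Touches : Fin n × Fin n → Set
  Touches e = proj₁ e ∈ₛ I ⊎ proj₂ e ∈ₛ I

  touches? : Decidable Touches
  touches? e = (proj₁ e ∈? I) ⊎-dec (proj₂ e ∈? I)

  interior? : Decidable (∁ Touches)
  interior? = ∁? touches?

  Touches-swap : ∀ {e} → Touches (swap e) → Touches e
  Touches-swap = Sum.swap

  ∈-ends⇒Touches : ∀ {e x} → x ∈ ends e → x ∈ₛ I → Touches e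
  ∈-ends⇒Touches (here refl)         x∈I = inj₁ x∈I
  ∈-ends⇒Touches (there (here refl)) x∈I = inj₂ x∈I

module _ {n : ℕ} (G : Graph n) (I : Subset n) where

  length-interior-mono : ∀ {M Q} → Unique (verts G M) → ContainedIn G M Q →
    length (filter (interior? I) M) ≤ length (filter (interior? I) Q)
  length-interior-mono {M} {Q} uM M⊆Q =
    length-≤-ContainedIn G (Unique-resp-⊒ (verts-⊑ G (filter-⊆ (interior? I) M)) uM) interior⊆
    where
    interior⊆ : ContainedIn G (filter (interior? I) M) (filter (interior? I) Q)
    interior⊆ = All.tabulate λ e∈ → let e∈M , int = ∈-filter⁻ (interior? I) {xs = M} e∈ in
      Sum.map (λ e∈Q → ∈-filter⁺ (interior? I) e∈Q int)
              (λ e′∈Q → ∈-filter⁺ (interior? I) e′∈Q (int ∘ Touches-swap I))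
              (All.lookup M⊆Q e∈M)

module _ {n : ℕ} (G : Graph n) {I : Subset n} (independent : Independent G I) where

  private
    E = Fin n × Fin n
    open DecMembership (_≟ᶠ_ {n}) using () renaming (_∈?_ to _∈ˡ?_)

  length-touching : ∀ (L : List E) → All (λ e → adj G (proj₁ e) (proj₂ e) ≡ true) L →
    length (filter (_∈? I) (verts G L)) ≡ length (filter (touches? I) L)
  length-touching []            []           = refl
  length-touching ((a , b) ∷ L) (ab ∷ edges) with a ∈? I
  ... | yes a∈ with b ∈? I
  ...   | yes b∈ with () ← trans (sym ab) (independent a b a∈ b∈)
  ...   | no  _  = cong suc (length-touching L edges)
  length-touching ((a , b) ∷ L) (ab ∷ edges) | no _ with b ∈? I
  ...   | yes _  = cong suc (length-touching L edges)
  ...   | no  _  = length-touching L edges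

  length-touching+interior : ∀ (L : List E) → All (λ e → adj G (proj₁ e) (proj₂ e) ≡ true) L →
    length (filter (_∈? I) (verts G L)) + length (filter (interior? I) L) ≡ length L
  length-touching+interior L edges =
    trans (cong (_+ length (filter (interior? I) L)) (length-touching L edges))
          (length-filter+length-filter-∁ (touches? I) L)

  length-<-avoiding-∈ : ∀ {u P} → PerfectAvoiding G u P → u ∈ₛ I →
    length P < ∣ I ∣ + length (filter (interior? I) P)
  length-<-avoiding-∈ {u} {P} (((edges , uP) , u∉) , _) u∈I =
    subst (_< ∣ I ∣ + interior) (length-touching+interior P edges) (+-monoˡ-< interior touched<)
    where
    interior = length (filter (interior? I) P)
    touched⊆I : u ∷ filter (_∈? I) (verts G P) ⊆ elements I
    touched⊆I (here refl) = ∈-elements⁺ u∈I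
    touched⊆I (there z∈)  = ∈-elements⁺ (proj₂ (∈-filter⁻ (_∈? I) {xs = verts G P} z∈))
    touched< : length (filter (_∈? I) (verts G P)) < ∣ I ∣
    touched< = subst (suc (length (filter (_∈? I) (verts G P))) ≤_) (length-elements I)
      (length-mono-⊆ _≟ᶠ_ (∉⇒Unique-∷ (u∉ ∘ proj₁ ∘ ∈-filter⁻ (_∈? I)) (Unique.filter⁺ (_∈? I) uP)) touched⊆I)

  length-≥-avoiding-∉ : ∀ {w Q} → PerfectAvoiding G w Q → w ∉ₛ I →
    ∣ I ∣ + length (filter (interior? I) Q) ≤ length Q
  length-≥-avoiding-∉ {w} {Q} (((edges , _) , _) , covers) w∉I =
    subst (∣ I ∣ + interior ≤_) (length-touching+interior Q edges) (+-monoˡ-≤ interior I≤touched)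
    where
    interior = length (filter (interior? I) Q)
    I⊆touched : elements I ⊆ filter (_∈? I) (verts G Q)
    I⊆touched z∈ = ∈-filter⁺ (_∈? I) (covers _ (λ { refl → w∉I (∈-elements⁻ z∈) })) (∈-elements⁻ z∈)
    I≤touched : ∣ I ∣ ≤ length (filter (_∈? I) (verts G Q))
    I≤touched = subst (_≤ length (filter (_∈? I) (verts G Q))) (length-elements I)
      (length-mono-⊆ _≟ᶠ_ (Unique-elements I) I⊆touched)

  record InteriorFirstMatching (P : List E) (k : ℕ) : Set where
    field
      avoided   : Fin n
      matching  : List E
      avoided∉I : avoided ∉ₛ I
      avoiding  : MatchingAvoiding G avoided matching
      length≡k  : length matching ≡ k
      interior⊑ : take k (filter (interior? I) P) ⊑ matching

  interior-first-matching : ∀ {P x} k → IsMatching G P → x ∈ₛ I → x ∈ verts G P → suc k ≤ length P →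
    InteriorFirstMatching P k
  interior-first-matching {P} {x} k matchingP@(edges , uP) x∈I x∈P k<P
    with ∈-verts⁻ G x∈P
  ... | e , e∈P , x∈e with partner G (All.lookup edges e∈P) x∈e
  ...   | w , w∈e , xw = record
    { avoided   = w
    ; matching  = M
    ; avoided∉I = w∉I
    ; avoiding  = IsMatching-resp-⊒ G (take-⊆ k Pi++B) matching++ , w∉M
    ; length≡k  = lengthM
    ; interior⊑ = take-⊑-take-++ k Pi B
    }
    where
    Pi = filter (interior? I) P
    T  = filter (touches? I) P
    B  = filter (λ f → ¬? (w ∈ˡ? ends f)) T
    Pi++B = Pi ++ B
    M = take k Pi++B

    w∉I : w ∉ₛ I
    w∉I w∈I with () ← trans (sym xw) (independent x w x∈I w∈I)

    Pi#T : Disjoint (verts G Pi) (verts G T)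
    Pi#T = Disjoint-verts-filter G (interior? I) (touches? I) {P} uP (λ ¬t t → ¬t t)

    B⊑T : B ⊑ T
    B⊑T = filter-⊆ _ T

    matchingT : IsMatching G T
    matchingT = IsMatching-resp-⊒ G (filter-⊆ (touches? I) P) matchingP

    matching++ : IsMatching G Pi++B
    matching++ = IsMatching-++ G (IsMatching-resp-⊒ G (filter-⊆ (interior? I) P) matchingP)
      (IsMatching-resp-⊒ G B⊑T matchingT) (λ (z∈Pi , z∈B) → Pi#T (z∈Pi , lookup (verts-⊑ G B⊑T) z∈B))

    w∉M : w ∉ verts G M
    w∉M w∈M
      with ∈-++⁻ (verts G Pi) (subst (w ∈_) (verts-++ G Pi B) (lookup (verts-⊑ G (take-⊆ k Pi++B)) w∈M))
    ... | inj₁ w∈Pi = Pi#T (w∈Pi , ∈-verts⁺ G (∈-filter⁺ (touches? I) e∈P (∈-ends⇒Touches I x∈e x∈I)) w∈e)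
    ... | inj₂ w∈B  with ∈-verts⁻ G {B} w∈B
    ...   | f , f∈B , w∈f = proj₂ (∈-filter⁻ (λ f → ¬? (w ∈ˡ? ends f)) {xs = T} f∈B) w∈f

    k≤Pi++B : k ≤ length Pi++B
    k≤Pi++B = ≤-pred (begin
      suc k                                   ≤⟨ k<P ⟩
      length P                                ≡⟨ sym (length-filter+length-filter-∁ (touches? I) P) ⟩
      length T + length Pi                    ≤⟨ +-monoˡ-≤ (length Pi) T≤1+B ⟩
      suc (length B + length Pi)              ≡⟨ cong suc (+-comm (length B) (length Pi)) ⟩
      suc (length Pi + length B)              ≡⟨ cong suc (length-++ Pi) ⟨
      suc (length Pi++B)                      ∎)
      where
      open ≤-Reasoning
      T≤1+B : length T ≤ suc (length B)
      T≤1+B = subst (_≤ suc (length B)) (length-filter+length-filter-∁ (λ f → w ∈ˡ? ends f) T)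
        (+-monoˡ-≤ (length B) (length-filter-∋≤1 G {T} w (proj₂ matchingT)))

    lengthM : length M ≡ k
    lengthM = trans (length-take k Pi++B) (m≤n⇒m⊓n≡m k≤Pi++B)

  module _ {k m} (n≡1+2m : n ≡ suc (m + m)) (k<m : suc k ≤ m)
    (extend : ∀ v M → MatchingAvoiding G v M → length M ≡ k →
       ∃ (λ P → PerfectAvoiding G v P × ContainedIn G M P)) where

    length-perfect : ∀ {v P} → PerfectAvoiding G v P → length P ≡ m
    length-perfect = length-PerfectAvoiding G n≡1+2m

    two-in-independent⇒bound : ∀ {u x P} → PerfectAvoiding G u P → u ∈ₛ I → x ∈ₛ I → x ≢ u → ∣ I ∣ + k ≤ m
    two-in-independent⇒bound {u} {x} {P} perfectP@((matchingP , _) , coversP) u∈I x∈I x≢u =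
      +⊓-≤⇒+-≤ ∣ I ∣ k (length Pi) m
        (begin
          ∣ I ∣ + k ⊓ length Pi                    ≤⟨ +-monoʳ-≤ ∣ I ∣ Pi≤Qi ⟩
          ∣ I ∣ + length (filter (interior? I) Q)  ≤⟨ length-≥-avoiding-∉ perfectQ avoided∉I ⟩
          length Q                                 ≡⟨ length-perfect perfectQ ⟩
          m                                        ∎)
        (subst (_< ∣ I ∣ + length Pi) (length-perfect perfectP) (length-<-avoiding-∈ perfectP u∈I))
      where
      open ≤-Reasoning
      Pi = filter (interior? I) P
      open InteriorFirstMatching (interior-first-matching k matchingP x∈I (coversP x x≢u)
        (subst (suc k ≤_) (sym (length-perfect perfectP)) k<m))
      extended = extend avoided matching avoiding length≡k
      Q = proj₁ extended
      perfectQ = proj₁ (proj₂ extended)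
      Pi≤Qi : k ⊓ length Pi ≤ length (filter (interior? I) Q)
      Pi≤Qi = subst (_≤ length (filter (interior? I) Q)) (length-take k Pi)
        (≤-trans (⊑⇒length≤length-filter (interior? I) (All.take⁺ k (All.all-filter (interior? I) P)) interior⊑)
                 (length-interior-mono G I (proj₂ (proj₁ avoiding)) (proj₂ (proj₂ extended))))

    independent-bound : (∀ v → ∃ (λ M → MatchingAvoiding G v M × length M ≡ k)) → ∣ I ∣ + k ≤ m
    independent-bound matchable =
      from-enumeration (elements I) (Unique-elements I) ∈-elements⁻ (length-elements I)
      where
      from-enumeration : ∀ xs → Unique xs → (∀ {z} → z ∈ xs → z ∈ₛ I) → length xs ≡ ∣ I ∣ → ∣ I ∣ + k ≤ m
      from-enumeration []          _        _  0≡∣I∣ = subst (λ a → a + k ≤ m) 0≡∣I∣ (≤-trans (n≤1+n k) k<m)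
      from-enumeration (_ ∷ [])    _        _  1≡∣I∣ = subst (λ a → a + k ≤ m) 1≡∣I∣ k<m
      from-enumeration (u ∷ x ∷ _) (u∉ ∷ _) ∈I _    =
        two-in-independent⇒bound (proj₁ (proj₂ extended)) (∈I (here refl)) (∈I (there (here refl)))
          (λ x≡u → All.head u∉ (sym x≡u))
        where
        M₀ = matchable u
        extended = extend u (proj₁ M₀) (proj₁ (proj₂ M₀)) (proj₂ (proj₂ M₀))

halfExtendable⇒α+k≤m : ∀ {n} (G : Graph n) {k m a} → n ≡ suc (m + m) → suc k ≤ m →
  HalfExtendable G k → IsIndependenceNumber G a → a + k ≤ m
halfExtendable⇒α+k≤m G n≡1+2m k<m (_ , matchable , extend) ((I , independent , refl) , _) =
  independent-bound G independent n≡1+2m k<m extend matchable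

module CompleteSplit {n : ℕ} (S : Subset n) where

  open DecMembership (_≟ᶠ_ {n}) using () renaming (_∈?_ to _∈ˡ?_)

  completeSplitGraph : Graph n
  completeSplitGraph = record
    { adj        = adjacent
    ; adj-sym    = λ u v → cong₂ (λ a b → not a ∧ not b) (does-≟-sym u v) (∧-comm (does (u ∈? S)) _)
    ; adj-irrefl = λ v → cong (λ a → not a ∧ not (does (v ∈? S) ∧ does (v ∈? S))) (dec-true (v ≟ᶠ v) refl)
    }
    where
    adjacent : Fin n → Fin n → Bool
    adjacent u v = not (does (u ≟ᶠ v)) ∧ not (does (u ∈? S) ∧ does (v ∈? S))
    does-≟-sym : ∀ u v → does (u ≟ᶠ v) ≡ does (v ≟ᶠ u)
    does-≟-sym u v with u ≟ᶠ v | v ≟ᶠ u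
    ... | yes _    | yes _   = refl
    ... | no  _    | no  _   = refl
    ... | yes refl | no  v≢u = ⊥-elim (v≢u refl)
    ... | no  u≢v  | yes refl = ⊥-elim (u≢v refl)

  private
    G = completeSplitGraph

  adj-∉ʳ : ∀ {u v} → u ≢ v → v ∉ₛ S → adj G u v ≡ true
  adj-∉ʳ {u} {v} u≢v v∉S
    rewrite dec-false (u ≟ᶠ v) u≢v | dec-false (v ∈? S) v∉S | ∧-zeroʳ (does (u ∈? S)) = refl

  adj-∉ˡ : ∀ {u v} → u ≢ v → u ∉ₛ S → adj G u v ≡ true
  adj-∉ˡ {u} {v} u≢v u∉S = trans (adj-sym G u v) (adj-∉ʳ (u≢v ∘ sym) u∉S)

  independent : Independent G S
  independent u v u∈S v∈S
    rewrite dec-true (u ∈? S) u∈S | dec-true (v ∈? S) v∈S = ∧-zeroʳ (not (does (u ≟ᶠ v)))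

  connected : ∣ S ∣ < n → Connected G
  connected ∣S∣<n u v with ∣p∣<n⇒∃∉ S ∣S∣<n
  ... | c , c∉S = to-c u (from-c v)
    where
    to-c : ∀ u → Reach G c v → Reach G u v
    to-c u r with u ≟ᶠ c
    ... | yes refl = r
    ... | no  u≢c  = step (adj-∉ʳ u≢c c∉S) r
    from-c : ∀ v → Reach G c v
    from-c v with c ≟ᶠ v
    ... | yes refl = here
    ... | no  c≢v  = step (adj-∉ˡ c≢v c∉S) here

  independence-number : 1 ≤ ∣ S ∣ → IsIndependenceNumber G ∣ S ∣
  independence-number 1≤∣S∣ = (S , independent , refl) , maximum
    where
    maximum : ∀ J → Independent G J → ∣ J ∣ ≤ ∣ S ∣
    maximum J independentJ with any? (λ c → (c ∈? J) ×-dec ¬? (c ∈? S))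
    ... | yes (c , c∈J , c∉S) = ≤-trans (p⊆q⇒∣p∣≤∣q∣ J⊆c) (subst (_≤ ∣ S ∣) (sym (∣⁅x⁆∣≡1 c)) 1≤∣S∣)
      where
      J⊆c : J ⊆ₛ ⁅ c ⁆
      J⊆c {z} z∈J with z ≟ᶠ c
      ... | yes refl = x∈⁅x⁆ c
      ... | no  z≢c  with () ← trans (sym (adj-∉ʳ z≢c c∉S)) (independentJ z c z∈J c∈J)
    ... | no ∄c = p⊆q⇒∣p∣≤∣q∣ J⊆S
      where
      J⊆S : J ⊆ₛ S
      J⊆S {z} z∈J with z ∈? S
      ... | yes z∈S = z∈S
      ... | no  z∉S = ⊥-elim (∄c (z , z∈J , z∉S))

  halves-matching : ∀ {zs : List (Fin n)} j → Unique zs → length zs ≡ j + j → All (_∉ₛ S) (drop j zs) →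
    IsMatching G (zip (take j zs) (drop j zs)) × verts G (zip (take j zs) (drop j zs)) ↭ zs
  halves-matching {zs} j uzs length≡ outside-S = (edges , uH) , permutation
    where
    H = zip (take j zs) (drop j zs)
    length-take≡j : length (take j zs) ≡ j
    length-take≡j = trans (length-take j zs) (m≤n⇒m⊓n≡m (subst (j ≤_) (sym length≡) (m≤m+n j j)))
    length-drop≡j : length (drop j zs) ≡ j
    length-drop≡j = trans (length-drop j zs) (trans (cong (_∸ j) length≡) (m+n∸m≡n j j))
    permutation : verts G H ↭ zs
    permutation = subst (verts G H ↭_) (take++drop≡id j zs)
      (concatMap-ends-zip-↭ {xs = take j zs} (trans length-take≡j (sym length-drop≡j)))
    uH : Unique (verts G H)
    uH = Unique-resp-↭ (↭-sym permutation) uzs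
    edges : All (λ e → adj G (proj₁ e) (proj₂ e) ≡ true) H
    edges = All.tabulate λ e∈ →
      adj-∉ʳ (ends-distinct G uH e∈) (All.lookup (All-zip-proj₂ (take j zs) outside-S) e∈)

  extension : ∀ {m v M} → n ≡ suc (m + m) → MatchingAvoiding G v M → length M + ∣ S ∣ ≤ m →
    ∃ λ P → PerfectAvoiding G v P × ContainedIn G M P
  extension {m} {v} {M} n≡1+2m ((edgesM , uM) , v∉M) room =
    M ++ H ,
    ((IsMatching-++ G (edgesM , uM) matchingH (λ (z∈M , z∈H) → unused z∈H (there z∈M)) , v∉P) , covers) ,
    All.tabulate (inj₁ ∘ ∈-++⁺ˡ)
    where
    used = v ∷ verts G M
    unused? = λ z → ¬? (z ∈ˡ? used)
    free = filter unused? (allFin n)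
    r = m ∸ length M
    length-free : length free ≡ r + r
    length-free = +-cancelʳ-≡ (length used) (length free) (r + r) (begin
      length free + length used                ≡⟨ length-unlisted (∉⇒Unique-∷ v∉M uM) ⟩
      n                                        ≡⟨ n≡1+2m ⟩
      suc (m + m)                              ≡⟨ cong (λ l → suc (l + l)) (m+[n∸m]≡n (m+n≤o⇒m≤o (length M) room)) ⟨
      suc ((length M + r) + (length M + r))    ≡⟨ rearrange (length M) r ⟩
      (r + r) + suc (length M + length M)      ≡⟨ cong (λ l → (r + r) + suc l) (length-verts G M) ⟨
      (r + r) + length used                    ∎)
      where
      open ≡-Reasoning
      rearrange : ∀ a r → suc ((a + r) + (a + r)) ≡ (r + r) + suc (a + a)
      rearrange = solve-∀
    zs = filter (_∈? S) free ++ filter (∁? (_∈? S)) free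
    zs↭free : zs ↭ free
    zs↭free = filter++filter-∁-↭ (_∈? S) free
    outside-S : All (_∉ₛ S) (drop r zs)
    outside-S = All.tabulate λ z∈ → proj₂ (∈-filter⁻ (∁? (_∈? S)) {xs = free}
      (drop-++-⊆ʳ r (filter (_∈? S) free) _ S-free≤r z∈))
      where
      S-free≤r : length (filter (_∈? S) free) ≤ r
      S-free≤r = ≤-trans
        (subst (length (filter (_∈? S) free) ≤_) (length-elements S)
          (length-mono-⊆ _≟ᶠ_ (Unique.filter⁺ (_∈? S) (Unique.filter⁺ unused? (allFin⁺ n)))
            (λ z∈ → ∈-elements⁺ (proj₂ (∈-filter⁻ (_∈? S) {xs = free} z∈)))))
        (m+n≤o⇒m≤o∸n ∣ S ∣ (subst (_≤ m) (+-comm (length M) ∣ S ∣) room))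
    halves = halves-matching r (Unique-resp-↭ (↭-sym zs↭free) (Unique.filter⁺ unused? (allFin⁺ n)))
               (trans (↭-length zs↭free) length-free) outside-S
    H = zip (take r zs) (drop r zs)
    matchingH = proj₁ halves
    H↭free : verts G H ↭ free
    H↭free = ↭-trans (proj₂ halves) zs↭free
    unused : ∀ {z} → z ∈ verts G H → z ∉ used
    unused z∈H = proj₂ (∈-filter⁻ unused? {xs = allFin n} (∈-resp-↭ H↭free z∈H))
    v∉P : v ∉ verts G (M ++ H)
    v∉P v∈P with ∈-++⁻ (verts G M) (subst (v ∈_) (verts-++ G M H) v∈P)
    ... | inj₁ v∈M = v∉M v∈M
    ... | inj₂ v∈H = unused v∈H (here refl)
    covers : ∀ z → z ≢ v → z ∈ verts G (M ++ H)
    covers z z≢v = subst (z ∈_) (sym (verts-++ G M H)) (covers′ (z ∈ˡ? verts G M))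
      where
      covers′ : Dec (z ∈ verts G M) → z ∈ verts G M ++ verts G H
      covers′ (yes z∈M) = ∈-++⁺ˡ z∈M
      covers′ (no  z∉M) = ∈-++⁺ʳ (verts G M) (∈-resp-↭ (↭-sym H↭free)
        (∈-filter⁺ unused? (∈-allFin z) λ { (here z≡v) → z≢v z≡v ; (there z∈M) → z∉M z∈M }))

  halfExtendable : ∀ {m k} → n ≡ suc (m + m) → k + ∣ S ∣ ≡ m → HalfExtendable G k
  halfExtendable {m} {k} n≡1+2m k+∣S∣≡m = connected ∣S∣<n , matchable , extend
    where
    ∣S∣≤m : ∣ S ∣ ≤ m
    ∣S∣≤m = m+n≤o⇒n≤o k (≤-reflexive k+∣S∣≡m)
    ∣S∣<n : ∣ S ∣ < n
    ∣S∣<n = subst (∣ S ∣ <_) (sym n≡1+2m) (s≤s (≤-trans ∣S∣≤m (m≤m+n m m)))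
    extend : ∀ v M → MatchingAvoiding G v M → length M ≡ k →
      ∃ (λ P → PerfectAvoiding G v P × ContainedIn G M P)
    extend v M avoiding refl = extension n≡1+2m avoiding (≤-reflexive k+∣S∣≡m)
    matchable : ∀ v → ∃ (λ M → MatchingAvoiding G v M × length M ≡ k)
    matchable v = take k P , (IsMatching-resp-⊒ G (take-⊆ k P) matchingP , v∉) ,
      trans (length-take k P)
            (m≤n⇒m⊓n≡m (subst (k ≤_) (sym (length-PerfectAvoiding G n≡1+2m perfectP)) k≤m))
      where
      k≤m = subst (k ≤_) k+∣S∣≡m (m≤m+n k ∣ S ∣)
      extended = extension n≡1+2m (([] , []) , λ ()) ∣S∣≤m
      P = proj₁ extended
      perfectP = proj₁ (proj₂ extended)
      matchingP = proj₁ (proj₁ perfectP)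
      v∉ : v ∉ verts G (take k P)
      v∉ v∈ = proj₂ (proj₁ perfectP) (lookup (verts-⊑ G (take-⊆ k P)) v∈)

completeSplitGraph-extremal : ∀ {n k m} → n ≡ suc (m + m) → suc k ≤ m →
  ∃ λ (G : Graph n) → HalfExtendable G k × IsIndependenceNumber G (m ∸ k)
completeSplitGraph-extremal {n} {k} {m} n≡1+2m k<m =
  completeSplitGraph ,
  halfExtendable n≡1+2m (trans (cong (k +_) ∣S∣≡t) (m+[n∸m]≡n (≤-trans (n≤1+n k) k<m))) ,
  subst (IsIndependenceNumber completeSplitGraph) ∣S∣≡t
    (independence-number (subst (1 ≤_) (sym ∣S∣≡t) (m+n≤o⇒m≤o∸n 1 k<m)))
  where
  t = m ∸ k
  t≤n : t ≤ n
  t≤n = subst (t ≤_) (sym n≡1+2m) (≤-trans (m∸n≤m m k) (≤-trans (m≤m+n m m) (n≤1+n (m + m))))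
  S = proj₁ (subset-of-size t t≤n)
  ∣S∣≡t = proj₂ (subset-of-size t t≤n)
  open CompleteSplit S

odd⇒≡1+2half : ∀ n → n % 2 ≡ 1 → n ≡ suc ((n ∸ 1) / 2 + (n ∸ 1) / 2)
odd⇒≡1+2half n odd = begin
  n                  ≡⟨ m≡m%n+[m/n]*n n 2 ⟩
  n % 2 + q * 2      ≡⟨ cong (_+ q * 2) odd ⟩
  suc (q * 2)        ≡⟨ cong suc (m*2≡m+m q) ⟩
  suc (q + q)        ≡⟨ cong (λ h → suc (h + h)) half≡q ⟨
  suc ((n ∸ 1) / 2 + (n ∸ 1) / 2) ∎
  where
  open ≡-Reasoning
  q = n / 2
  m*2≡m+m : ∀ m → m * 2 ≡ m + m
  m*2≡m+m = solve-∀
  half≡q : (n ∸ 1) / 2 ≡ q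
  half≡q = trans (cong (λ l → (l ∸ 1) / 2) (trans (m≡m%n+[m/n]*n n 2) (cong (_+ q * 2) odd))) (m*n/n≡m q 2)

odd-order-bounds : ∀ {n} k → n % 2 ≡ 1 → 2 * k + 3 ≤ n →
  n ≡ suc ((n ∸ 1) / 2 + (n ∸ 1) / 2) × suc k ≤ (n ∸ 1) / 2
odd-order-bounds {n} k odd 2k+3≤n =
  n≡1+2m , half-mono-≤ (suc k) m (≤-pred (subst₂ _≤_ (2k+3≡ k) n≡1+2m 2k+3≤n))
  where
  m = (n ∸ 1) / 2
  n≡1+2m = odd⇒≡1+2half n odd
  2k+3≡ : ∀ k → 2 * k + 3 ≡ suc (suc k + suc k)
  2k+3≡ = solve-∀

theorem11 :
    (∀ (k n : ℕ) (G : Graph n) → n % 2 ≡ 1 → 2 * k + 3 ≤ n →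
       HalfExtendable G k → ∀ a → IsIndependenceNumber G a →
       a ≤ (n ∸ 1) / 2 ∸ k)
    ×
    (∀ (k n : ℕ) → n % 2 ≡ 1 → 2 * k + 3 ≤ n →
       ∃ (λ (G : Graph n) → HalfExtendable G k ×
          IsIndependenceNumber G ((n ∸ 1) / 2 ∸ k)))
theorem11 =
  (λ k n G odd 2k+3≤n extendable a α →
    let n≡1+2m , k<m = odd-order-bounds k odd 2k+3≤n
    in m+n≤o⇒m≤o∸n a (halfExtendable⇒α+k≤m G n≡1+2m k<m extendable α)) ,
  (λ k n odd 2k+3≤n →
    let n≡1+2m , k<m = odd-order-bounds k odd 2k+3≤n
    in completeSplitGraph-extremal n≡1+2m k<m)
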